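{- For every positive integer $n$, $\beta(F_{n+1})\le 2\beta(Q_n)$.
   Context: $Q_n$ is the hypercube with vertex set $\{0,1\}^n$, vertices adjacent iff they differ in exactly one coordinate; for $u\in\{0,1\}^m$, $\overline{u}=u+(1,\dots,1)\pmod 2$. The folded hypercube $F_m$ has vertex set $\{\{u,\overline{u}\}:u\in\{0,1\}^m\}$, with $\{u,\overline u\}$ adjacent to $\{v,\overline v\}$ iff $uv$ or $u\overline v$ is an edge of $Q_m$; equivalently $d_{F_m}(\{u,\overline u\},\{v,\overline v\})=\min\{d_{Q_m}(u,v),m-d_{Q_m}(u,v)\}$. For a graph $G$, a set $S\subseteq V(G)$ is resolving if for all distinct $u,v$ some $y\in S$ has $d_G(u,y)\neq d_G(v,y)$, and $\beta(G)$ is the minimum size of a resolving set. -}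

module Defs where

open import Data.Nat using (ℕ; zero; suc; _+_; _∸_; _≤_; _⊔_; _⊓_)
open import Data.Bool using (Bool; true; false; not; if_then_else_)
open import Data.Vec using (Vec; []; _∷_; map)
open import Data.List using (List; length)
open import Data.List.Membership.Propositional using (_∈_)
import Data.List.Relation.Unary.AllPairs
open import Data.List.Relation.Unary.Any using (Any)
open import Data.Product using (Σ; _×_; ∃)
open import Relation.Binary.PropositionalEquality using (_≡_)
open import Relation.Nullary using (¬_)
open import Data.Sum using (_⊎_)

-- Hamming distance on {0,1}^n (= graph distance in the hypercube Q_n)
hamming : ∀ {n} → Vec Bool n → Vec Bool n → ℕ
hamming [] [] = 0
hamming (x ∷ xs) (y ∷ ys) = (if x Data.Bool.xor y then 1 else 0) + hamming xs ys

compl : ∀ {n} → Vec Bool n → Vec Bool n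
compl = map not

record MetricGraph : Set₁ where
  field
    V    : Set
    _≈_  : V → V → Set
    dist : V → V → ℕ
open MetricGraph public

Q : ℕ → MetricGraph
Q n = record { V = Vec Bool n ; _≈_ = _≡_ ; dist = hamming }

-- Folded hypercube F_m : a vertex {u, u̅} is represented by either of u, u̅;
-- two representatives denote the same vertex iff v ≡ u or v ≡ u̅;
-- d_F({u,u̅},{v,v̅}) = min (d_Q(u,v), m − d_Q(u,v))  (independent of representatives)
F : ℕ → MetricGraph
F m = record
  { V = Vec Bool m
  ; _≈_ = λ u v → (u ≡ v) ⊎ (u ≡ compl v)
  ; dist = λ u v → hamming u v ⊓ (m ∸ hamming u v)
  }

Resolving : (G : MetricGraph) → List (V G) → Set
Resolving G S = ∀ (u v : V G) → ¬ (_≈_ G u v) →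
  Any (λ y → ¬ (dist G u y ≡ dist G v y)) S

-- A set of vertices of G with k elements: a list of pairwise distinct vertices
-- (distinct as vertices of G, i.e. up to _≈_ G)
DistinctVerts : (G : MetricGraph) → List (V G) → Set
DistinctVerts G S = Data.List.Relation.Unary.AllPairs.AllPairs (λ x y → ¬ (_≈_ G x y)) S

IsMetricDimension : (G : MetricGraph) → ℕ → Set
IsMetricDimension G k =
  (Σ (List (V G)) λ S → DistinctVerts G S × Resolving G S × length S ≡ k)
  × (∀ (S : List (V G)) → DistinctVerts G S → Resolving G S → k ≤ length S)

{-# OPTIONS --safe #-}
-- Let S resolve Q_n. Every vertex of F_{n+1} has a representative 0u, and for s ∈ S
-- with h = d(u, s) we get d_F(0u, 0s) = φ(h) and d_F(0u, 1s) = φ(h + 1), where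
-- φ(a) = min(a, n + 1 − a). Since φ(a) = φ(b) forces a = b or a + b = n + 1, the pair
-- (φ(h), φ(h + 1)) determines h, so the vertices 0s, 1s (s ∈ S) resolve F_{n+1}.
-- As 1s and 0s̄ are the same vertex of F_{n+1}, dropping 1s whenever s̄ ∈ S leaves
-- at most 2|S| distinct vertices.
module Submission where

open import Defs
open import Data.Nat using (ℕ; suc; _+_; _∸_; _*_; _⊓_; _≤_; _<_; s≤s; _≟_)
open import Data.Nat.Properties
open import Data.Bool using (Bool; true; false; if_then_else_) renaming (_≟_ to _≟ᵇ_)
open import Data.Bool.Properties using (not-distribˡ-xor; not-distribʳ-xor; not-involutive; not-¬)
open import Data.Vec using (Vec; []; _∷_)
open import Data.Vec.Properties using (≡-dec; ∷-injectiveˡ; ∷-injectiveʳ)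
open import Data.List using (List; length; map; _++_; filter)
open import Data.List.Properties using (length-++; length-map; length-filter)
open import Data.List.Membership.Propositional using (_∈_; find)
open import Data.List.Membership.Propositional.Properties using (∈-map⁺; ∈-map⁻; ∈-++⁺ˡ; ∈-++⁺ʳ; ∈-filter⁺; ∈-filter⁻)
import Data.List.Membership.DecPropositional as DecMembership
open import Data.List.Relation.Unary.Any as Any using (Any)
open import Data.List.Relation.Unary.All using (tabulate)
open import Data.List.Relation.Unary.AllPairs as AllPairs using (AllPairs)
open import Data.List.Relation.Unary.AllPairs.Properties using (++⁺; map⁺; filter⁺)
open import Data.Product using (∃; _,_; proj₂)
open import Data.Sum using (_⊎_; inj₁; inj₂)
open import Function using (_∘_)
open import Relation.Nullary using (¬_; Dec; yes; no; ¬?; contradiction)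
open import Relation.Binary.PropositionalEquality

-- dist (F m) u v is definitionally folded m (hamming u v).
folded : ℕ → ℕ → ℕ
folded m a = a ⊓ (m ∸ a)

folded-reflect : ∀ {m a} → a ≤ m → folded m (m ∸ a) ≡ folded m a
folded-reflect {m} {a} a≤m = trans (cong ((m ∸ a) ⊓_) (m∸[m∸n]≡n a≤m)) (⊓-comm (m ∸ a) a)

folded-injective : ∀ {m a b} → a ≤ m → b ≤ m → folded m a ≡ folded m b → a ≡ b ⊎ a + b ≡ m
folded-injective {m} {a} {b} a≤m b≤m eq with ⊓-sel a (m ∸ a) | ⊓-sel b (m ∸ b)
... | inj₁ fa | inj₁ fb = inj₁ (trans (sym fa) (trans eq fb))
... | inj₁ fa | inj₂ fb = inj₂ (trans (cong (_+ b) (trans (sym fa) (trans eq fb))) (m∸n+n≡m b≤m))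
... | inj₂ fa | inj₁ fb = inj₂ (trans (cong (a +_) (trans (sym fb) (trans (sym eq) fa))) (m+[n∸m]≡n a≤m))
... | inj₂ fa | inj₂ fb = inj₁ (∸-cancelˡ-≡ a≤m b≤m (trans (sym fa) (trans eq fb)))

folded-step-injective : ∀ {m a b} → a < m → b < m →
  folded m a ≡ folded m b → folded m (suc a) ≡ folded m (suc b) → a ≡ b
folded-step-injective {a = a} {b = b} a<m b<m eq eq₊
  with folded-injective (<⇒≤ a<m) (<⇒≤ b<m) eq | folded-injective a<m b<m eq₊
... | inj₁ a≡b | _              = a≡b
... | inj₂ _   | inj₁ 1+a≡1+b   = suc-injective 1+a≡1+b
... | inj₂ sum | inj₂ sum₊      = contradiction (+-mono-< (n<1+n a) (n<1+n b))
                                    (<-irrefl (trans sum (sym sum₊)))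

hamming-compl-+ : ∀ {n} (x y : Vec Bool n) → hamming (compl x) y + hamming x y ≡ n
hamming-compl-+ []          []          = refl
hamming-compl-+ (false ∷ x) (false ∷ y) = cong suc (hamming-compl-+ x y)
hamming-compl-+ (true ∷ x)  (true ∷ y)  = cong suc (hamming-compl-+ x y)
hamming-compl-+ (false ∷ x) (true ∷ y)  = trans (+-suc _ _) (cong suc (hamming-compl-+ x y))
hamming-compl-+ (true ∷ x)  (false ∷ y) = trans (+-suc _ _) (cong suc (hamming-compl-+ x y))

hamming-≤ : ∀ {n} (x y : Vec Bool n) → hamming x y ≤ n
hamming-≤ x y = subst (hamming x y ≤_) (hamming-compl-+ x y) (m≤n+m _ _)

hamming-complˡ : ∀ {n} (x y : Vec Bool n) → hamming (compl x) y ≡ n ∸ hamming x y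
hamming-complˡ x y = trans (sym (m+n∸n≡m _ (hamming x y))) (cong (_∸ hamming x y) (hamming-compl-+ x y))

hamming-compl-swap : ∀ {n} (x y : Vec Bool n) → hamming x (compl y) ≡ hamming (compl x) y
hamming-compl-swap []      []      = refl
hamming-compl-swap (a ∷ x) (b ∷ y) =
  cong₂ _+_ (cong (λ c → if c then 1 else 0) (trans (sym (not-distribʳ-xor a b)) (not-distribˡ-xor a b)))
            (hamming-compl-swap x y)

hamming-complʳ : ∀ {n} (x y : Vec Bool n) → hamming x (compl y) ≡ n ∸ hamming x y
hamming-complʳ x y = trans (hamming-compl-swap x y) (hamming-complˡ x y)

compl-involutive : ∀ {n} (x : Vec Bool n) → compl (compl x) ≡ x
compl-involutive []      = refl
compl-involutive (b ∷ x) = cong₂ _∷_ (not-involutive b) (compl-involutive x)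

_≈F_ : ∀ {m} → Vec Bool m → Vec Bool m → Set
_≈F_ {m} = _≈_ (F m)

dist-F-complˡ : ∀ {m} (x y : Vec Bool m) → dist (F m) (compl x) y ≡ dist (F m) x y
dist-F-complˡ {m} x y = trans (cong (folded m) (hamming-complˡ x y)) (folded-reflect (hamming-≤ x y))

dist-F-complʳ : ∀ {m} (x y : Vec Bool m) → dist (F m) x (compl y) ≡ dist (F m) x y
dist-F-complʳ {m} x y = trans (cong (folded m) (hamming-complʳ x y)) (folded-reflect (hamming-≤ x y))

dist-F-resp-≈ : ∀ {m} {x x′ y y′ : Vec Bool m} → x ≈F x′ → y ≈F y′ → dist (F m) x y ≡ dist (F m) x′ y′
dist-F-resp-≈ {x′ = x′} {y′ = y′} x≈x′ y≈y′ = trans (left x≈x′) (right y≈y′)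
  where
  left : ∀ {x} → x ≈F x′ → dist (F _) x _ ≡ dist (F _) x′ _
  left (inj₁ refl) = refl
  left (inj₂ refl) = dist-F-complˡ x′ _
  right : ∀ {y} → y ≈F y′ → dist (F _) x′ y ≡ dist (F _) x′ y′
  right (inj₁ refl) = refl
  right (inj₂ refl) = dist-F-complʳ x′ y′

canon : ∀ {n} → Vec Bool (suc n) → Vec Bool n
canon (false ∷ u) = u
canon (true ∷ u)  = compl u

canon-≈ : ∀ {n} (x : Vec Bool (suc n)) → (false ∷ canon x) ≈F x
canon-≈ (false ∷ u) = inj₁ refl
canon-≈ (true ∷ u)  = inj₂ refl

canon-≡⇒≈ : ∀ {n} (x z : Vec Bool (suc n)) → canon x ≡ canon z → x ≈F z
canon-≡⇒≈ (false ∷ u) (false ∷ w) u≡w  = inj₁ (cong (false ∷_) u≡w)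
canon-≡⇒≈ (false ∷ u) (true ∷ w)  u≡w̄  = inj₂ (cong (false ∷_) u≡w̄)
canon-≡⇒≈ (true ∷ u)  (false ∷ w) ū≡w  = inj₂ (cong (true ∷_) (trans (sym (compl-involutive u)) (cong compl ū≡w)))
canon-≡⇒≈ (true ∷ u)  (true ∷ w)  ū≡w̄  =
  inj₁ (cong (true ∷_) (trans (sym (compl-involutive u)) (trans (cong compl ū≡w̄) (compl-involutive w))))

≈F-sameHead : ∀ {n b} {s t : Vec Bool n} → (b ∷ s) ≈F (b ∷ t) → s ≡ t
≈F-sameHead (inj₁ refl) = refl
≈F-sameHead (inj₂ eq)   = contradiction (∷-injectiveˡ eq) (not-¬ refl)

≈F-flipHead : ∀ {n} {s t : Vec Bool n} → (false ∷ s) ≈F (true ∷ t) → s ≡ compl t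
≈F-flipHead (inj₂ eq) = ∷-injectiveʳ eq

separating-head : ∀ {n} (u w s : Vec Bool n) → hamming u s ≢ hamming w s →
  ∃ λ b → dist (F (suc n)) (false ∷ u) (b ∷ s) ≢ dist (F (suc n)) (false ∷ w) (b ∷ s)
separating-head u w s h≢h′ with dist (F _) (false ∷ u) (false ∷ s) ≟ dist (F _) (false ∷ w) (false ∷ s)
... | no  sep = false , sep
... | yes eq  = true , h≢h′ ∘ folded-step-injective (s≤s (hamming-≤ u s)) (s≤s (hamming-≤ w s)) eq

module _ {n : ℕ} (S : List (Vec Bool n)) where
  open DecMembership (≡-dec {n = n} _≟ᵇ_) using (_∈?_; _∉_)

  unpaired? : (s : Vec Bool n) → Dec (compl s ∉ S)
  unpaired? s = ¬? (compl s ∈? S)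

  liftLandmarks : List (Vec Bool (suc n))
  liftLandmarks = map (false ∷_) S ++ map (true ∷_) (filter unpaired? S)

  length-liftLandmarks : length liftLandmarks ≤ 2 * length S
  length-liftLandmarks = begin
    length liftLandmarks
      ≡⟨ length-++ (map (false ∷_) S) ⟩
    length (map (false ∷_) S) + length (map (true ∷_) (filter unpaired? S))
      ≡⟨ cong₂ _+_ (length-map (false ∷_) S) (length-map (true ∷_) (filter unpaired? S)) ⟩
    length S + length (filter unpaired? S)
      ≤⟨ +-monoʳ-≤ (length S) (length-filter unpaired? S) ⟩
    length S + length S
      ≡⟨ cong (length S +_) (sym (+-identityʳ (length S))) ⟩
    2 * length S ∎
    where open ≤-Reasoning

  liftLandmarks-distinct : AllPairs _≢_ S → DistinctVerts (F (suc n)) liftLandmarks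
  liftLandmarks-distinct distinct =
    ++⁺ (map⁺ (AllPairs.map (_∘ ≈F-sameHead) distinct))
        (map⁺ (AllPairs.map (_∘ ≈F-sameHead) (filter⁺ unpaired? distinct)))
        (tabulate λ x∈ → tabulate λ y∈ → heads-distinct x∈ y∈)
    where
    heads-distinct : ∀ {x y} → x ∈ map (false ∷_) S → y ∈ map (true ∷_) (filter unpaired? S) → ¬ x ≈F y
    heads-distinct x∈ y∈ x≈y with ∈-map⁻ (false ∷_) x∈ | ∈-map⁻ (true ∷_) y∈
    ... | s , s∈S , refl | t , t∈ , refl =
      proj₂ (∈-filter⁻ unpaired? {xs = S} t∈) (subst (_∈ S) (≈F-flipHead x≈y) s∈S)

  liftLandmarks-cover : ∀ {s} → s ∈ S → ∀ b → Any ((b ∷ s) ≈F_) liftLandmarks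
  liftLandmarks-cover s∈S false = Any.map inj₁ (∈-++⁺ˡ (∈-map⁺ (false ∷_) s∈S))
  liftLandmarks-cover {s} s∈S true with compl s ∈? S
  ... | yes s̄∈S = Any.map (λ eq → inj₂ (trans (cong (true ∷_) (sym (compl-involutive s))) (cong compl eq)))
                          (∈-++⁺ˡ (∈-map⁺ (false ∷_) s̄∈S))
  ... | no  s̄∉S = Any.map inj₁ (∈-++⁺ʳ (map (false ∷_) S) (∈-map⁺ (true ∷_) (∈-filter⁺ unpaired? s∈S s̄∉S)))

  liftLandmarks-resolving : Resolving (Q n) S → Resolving (F (suc n)) liftLandmarks
  liftLandmarks-resolving resolves x z x≉z
    with find (resolves (canon x) (canon z) (x≉z ∘ canon-≡⇒≈ x z))
  ... | s , s∈S , h≢h′ with separating-head (canon x) (canon z) s h≢h′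
  ... | b , sep = Any.map separates (liftLandmarks-cover s∈S b)
    where
    separates : ∀ {y} → (b ∷ s) ≈F y → dist (F (suc n)) x y ≢ dist (F (suc n)) z y
    separates bs≈y eq =
      sep (trans (dist-F-resp-≈ (canon-≈ x) bs≈y) (trans eq (sym (dist-F-resp-≈ (canon-≈ z) bs≈y))))

-- The construction works for every n, so the hypothesis 1 ≤ n is unused.
lemma7 : ∀ (n : ℕ) → 1 ≤ n → ∀ (a b : ℕ) →
    IsMetricDimension (Q n) a → IsMetricDimension (F (suc n)) b → b ≤ 2 * a
lemma7 n _ _ b ((S , S-distinct , S-resolving , refl) , _) (_ , F-minimal) =
  ≤-trans (F-minimal (liftLandmarks S) (liftLandmarks-distinct S S-distinct)
                                        (liftLandmarks-resolving S S-resolving))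
          (length-liftLandmarks S)
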